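{- For $n\ge2$ and distinct $i,j\in[n]$ let $a_n(i,j)=\sum q^{\mathrm{desc}(\pi)}$ over $\pi\in\mathcal{S}_n(1324,1342)$ with $\pi_1=i$, $\pi_2=j$; let $a_n(i)=\sum_{j\ne i}a_n(i,j)$ for $n\ge2$, $a_1(1)=1$, and $a_n=\sum_{i=1}^na_n(i)$. Then $$a_n(i,n)=q\,a_{n-1}(i,n-1)+q\sum_{j=1}^{i}a_{n-2}(j),\quad 1\le i\le n-3,$$ $$a_n(n-2,n)=q^2a_{n-3}+q\sum_{j=1}^{n-3}a_{n-2}(j),\quad n\ge4,$$ and $a_n(i,i+1)=a_{n-1}(i)$ for $1\le i\le n-1$, while $a_n(i,j)=0$ for $2\le i+1<j<n$.
   Context: $\mathcal{S}_n(1324,1342)$ is the set of permutations of $[n]$ avoiding the patterns $1324$ and $1342$; $\mathrm{desc}(\pi)$ is the number of indices $k$ with $\pi_k>\pi_{k+1}$. -}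

module Defs where

open import Level using (Level)
open import Data.Bool using (Bool; true; false; _∧_; _∨_; if_then_else_; not)
open import Data.Nat using (ℕ; zero; suc; _+_; _∸_; _<ᵇ_; _≡ᵇ_)
open import Data.List using (List; []; _∷_; map; concatMap; filter; foldr; upTo; length)
open import Data.Bool.ListAction using (any; all)
open import Relation.Nullary.Decidable using (Dec)
open import Data.Bool using (T)
open import Data.Bool.Properties using (T?)
open import Algebra.Bundles using (CommutativeSemiring)

-- Permutations of [n] = {1,…,n}, as one-line notation lists π₁ π₂ … πₙ

range : ℕ → List ℕ
range n = map suc (upTo n)

words : ℕ → ℕ → List (List ℕ)
words n zero    = [] ∷ []
words n (suc k) = concatMap (λ x → map (x ∷_) (words n k)) (range n)

notIn : ℕ → List ℕ → Bool
notIn x ys = all (λ y → not (x ≡ᵇ y)) ys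

distinct : List ℕ → Bool
distinct []       = true
distinct (x ∷ xs) = notIn x xs ∧ distinct xs

perms : ℕ → List (List ℕ)
perms n = filter (λ w → T? (distinct w)) (words n n)

choose : ℕ → List ℕ → List (List ℕ)
choose zero    _        = [] ∷ []
choose (suc k) []       = []
choose (suc k) (x ∷ xs) = map (x ∷_) (choose k xs) ++ choose (suc k) xs
  where
  open import Data.List using (_++_)

-- a length-4 sequence x₁x₂x₃x₄ is order-isomorphic to 1324 iff x₁<x₃<x₂<x₄
is1324 : List ℕ → Bool
is1324 (x₁ ∷ x₂ ∷ x₃ ∷ x₄ ∷ []) = (x₁ <ᵇ x₃) ∧ (x₃ <ᵇ x₂) ∧ (x₂ <ᵇ x₄)
is1324 _ = false

-- a length-4 sequence x₁x₂x₃x₄ is order-isomorphic to 1342 iff x₁<x₄<x₂<x₃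
is1342 : List ℕ → Bool
is1342 (x₁ ∷ x₂ ∷ x₃ ∷ x₄ ∷ []) = (x₁ <ᵇ x₄) ∧ (x₄ <ᵇ x₂) ∧ (x₂ <ᵇ x₃)
is1342 _ = false

contains1324 : List ℕ → Bool
contains1324 π = any is1324 (choose 4 π)

contains1342 : List ℕ → Bool
contains1342 π = any is1342 (choose 4 π)

avoiders : ℕ → List (List ℕ)
avoiders n = filter (λ π → T? (not (contains1324 π) ∧ not (contains1342 π))) (perms n)

desc : List ℕ → ℕ
desc []           = 0
desc (x ∷ [])     = 0
desc (x ∷ y ∷ zs) = (if y <ᵇ x then 1 else 0) + desc (y ∷ zs)

startsWith : ℕ → ℕ → List ℕ → Bool
startsWith i j (x ∷ y ∷ _) = (x ≡ᵇ i) ∧ (y ≡ᵇ j)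
startsWith i j _           = false

-- The generating polynomials, evaluated at q in an arbitrary commutative
-- semiring R (taking R = ℕ[q] recovers the formal polynomials).

module Gen {c ℓ : Level} (R : CommutativeSemiring c ℓ) where
  open CommutativeSemiring R using (Carrier; 0#; 1#) renaming (_+_ to _⊕_; _*_ to _⊛_)

  pow : Carrier → ℕ → Carrier
  pow q zero    = 1#
  pow q (suc k) = q ⊛ pow q k

  sumR : List Carrier → Carrier
  sumR = foldr _⊕_ 0#

  a2 : Carrier → ℕ → ℕ → ℕ → Carrier
  a2 q n i j = sumR (map (λ π → pow q (desc π))
                         (filter (λ π → T? (startsWith i j π)) (avoiders n)))

  -- a_n(i) = Σ_{j ∈ [n], j ≠ i} a_n(i,j) for n ≥ 2, a_1(1) = 1
  -- (values outside the paper's range, a_0(i) and a_1(i) for i ≠ 1, are set to 0)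
  a1 : Carrier → ℕ → ℕ → Carrier
  a1 q zero i = 0#
  a1 q (suc zero) i = if i ≡ᵇ 1 then 1# else 0#
  a1 q n@(suc (suc _)) i =
    sumR (map (λ j → a2 q n i j) (filter (λ j → T? (not (j ≡ᵇ i))) (range n)))

  a0 : Carrier → ℕ → Carrier
  a0 q n = sumR (map (a1 q n) (range n))

  a1sum : Carrier → ℕ → ℕ → Carrier
  a1sum q n m = sumR (map (a1 q n) (range m))

-- Every identity comes from a bijection between classes of (1324,1342)-avoiders that shifts desc by a
-- known amount. In π = i n t ρ the maximum n contributes exactly one descent, and t is n−1 or at most i+1,
-- since otherwise i t (i+1) (n−1) or i t (n−1) (i+1) is a 1324 or a 1342. If t = n−1, deleting n gives an
-- avoider starting i (n−1); otherwise deleting i and n and standardising gives an avoider of length n−2 whose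
-- first entry is at most min(i, n−3), and every such avoider arises. In the same way a leading pair i (i+1)
-- can be merged into i without changing desc, a leading maximum can be removed at the cost of one descent,
-- and for i+1 < j < n the prefix i j forces i j (i+1) n or i j n (i+1). Finally Σ_{j≤b} a_n(j) is the
-- q^desc-weight of the avoiders whose first entry is at most b.

module Submission where

open import Defs
open import Level using (Level)
open import Data.Nat using (ℕ; _∸_; _≤_; _<_; suc)
open import Data.Product using (_×_)
open import Algebra.Bundles using (CommutativeSemiring)

open import Data.Bool using (Bool; true; false; _∧_; _∨_; not; T; if_then_else_)
open import Data.Bool.Properties using (T?; T-≡; T-not-≡; T-∧; T-∨; ∨-assoc; ∨-idem; ∨-zeroʳ; ∧-zeroʳ)
open import Data.Bool.ListAction using (any)
open import Data.Nat as Nat using (zero; _<ᵇ_; _≡ᵇ_; z≤n; s≤s; pred; _⊓_)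
open import Data.Nat.Properties
  using (<-irrefl; <-trans; <-≤-connex; <-≤-trans; ≤-<-trans; <ᵇ⇒<; <⇒<ᵇ; <⇒≤; _≟_; m≤n⇒m≤1+n;
         m⊓n≤m; m⊓n≤n; m≤n⇒m⊓n≡m; m≥n⇒m⊓n≡n; n<1+n; n≤0⇒n≡0; n≤1+n; pred-mono-≤; suc-injective;
         ≡ᵇ⇒≡; ≡⇒≡ᵇ; ≤-antisym; ≤-pred; ≤-refl; ≤-reflexive; ≤-trans; ≤∧≢⇒<; ⊓-glb; module ≤-Reasoning)
open import Data.List using (List; []; _∷_; map; _++_; length; upTo; concatMap; filter; cartesianProductWith)
open import Data.List.Properties
  using (map-++; map-∘; length-map; length-upTo; map-injective; map-id-local; ∷-injective; ∷-injectiveˡ; ∷-injectiveʳ)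
open import Data.Product using (_,_; proj₁; proj₂; ∃; uncurry)
open import Data.Sum as Sum using (_⊎_; inj₁; inj₂; [_,_])
open import Data.Empty using (⊥; ⊥-elim)
open import Data.Unit using (tt)
open import Function using (_∘_; _⇔_; mk⇔; Equivalence)
open import Relation.Binary.PropositionalEquality as ≡
  using (_≡_; _≢_; ≢-sym; refl; sym; trans; cong; cong₂; subst; module ≡-Reasoning)
open import Relation.Nullary using (yes; no)
open import Data.List.Relation.Unary.All as All using (All; []; _∷_)
open import Data.List.Relation.Unary.All.Properties using (¬Any⇒All¬; All¬⇒¬Any; all⁺; all⁻)
open import Data.List.Relation.Unary.AllPairs as AllPairs using ([]; _∷_)
open import Data.List.Relation.Unary.Any as Any using (here; there)
open import Data.List.Relation.Unary.Any.Properties using (any⁺; any⁻)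
open import Data.List.Relation.Unary.Unique.Propositional using (Unique)
import Data.List.Relation.Unary.Unique.Propositional.Properties as Unique
open import Data.List.Membership.Propositional using (_∈_; _∉_; lose)
open import Data.List.Membership.Propositional.Properties
  using (∈-map⁺; ∈-map⁻; ∈-++⁺ˡ; ∈-++⁺ʳ; ∈-++⁻; ∈-upTo⁺; ∈-upTo⁻; ∈-filter⁺; ∈-filter⁻;
         ∈-cartesianProductWith⁺; ∈-cartesianProductWith⁻)
open import Data.List.Membership.Propositional.Properties.WithK using (unique∧set⇒bag)
open import Data.List.Membership.DecPropositional _≟_ using (_∈?_)
open import Data.List.Relation.Binary.BagAndSetEquality using (∼bag⇒↭)
open import Data.List.Relation.Binary.Permutation.Propositional using (_↭_; ↭⇒↭ₛ′)
import Data.List.Relation.Binary.Permutation.Propositional.Properties as Permutation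

private
  variable
    A B : Set

<⇒<ᵇ≡true : ∀ {x y} → x < y → (x <ᵇ y) ≡ true
<⇒<ᵇ≡true p = Equivalence.to T-≡ (<⇒<ᵇ p)

≥⇒<ᵇ≡false : ∀ {x y} → y ≤ x → (x <ᵇ y) ≡ false
≥⇒<ᵇ≡false {x} {zero}  _       = refl
≥⇒<ᵇ≡false {suc x} {suc y} (s≤s p) = ≥⇒<ᵇ≡false p

<ᵇ-cases : ∀ x y → (x < y × (x <ᵇ y) ≡ true) ⊎ (y ≤ x × (x <ᵇ y) ≡ false)
<ᵇ-cases x y with <-≤-connex x y
... | inj₁ x<y = inj₁ (x<y , <⇒<ᵇ≡true x<y)
... | inj₂ y≤x = inj₂ (y≤x , ≥⇒<ᵇ≡false y≤x)

isPattern : List ℕ → Bool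
isPattern c = is1324 c ∨ is1342 c

isPattern-map : ∀ (f : ℕ → ℕ) → (∀ u v → (f u <ᵇ f v) ≡ (u <ᵇ v)) →
                ∀ c → isPattern (map f c) ≡ isPattern c
isPattern-map f mono (a ∷ b ∷ d ∷ e ∷ [])
  rewrite mono a d | mono d b | mono b e | mono a e | mono e b | mono b d = refl
isPattern-map f mono []                    = refl
isPattern-map f mono (a ∷ [])              = refl
isPattern-map f mono (a ∷ b ∷ [])          = refl
isPattern-map f mono (a ∷ b ∷ d ∷ [])      = refl
isPattern-map f mono (a ∷ b ∷ d ∷ e ∷ _ ∷ _) = refl

isPattern-max-first : ∀ {y c} → All (_< y) c → isPattern (y ∷ c) ≡ false
isPattern-max-first {c = a ∷ b ∷ d ∷ []} (_ ∷ b<y ∷ d<y ∷ [])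
  rewrite ≥⇒<ᵇ≡false (<⇒≤ b<y) | ≥⇒<ᵇ≡false (<⇒≤ d<y) = refl
isPattern-max-first {c = []}                    _ = refl
isPattern-max-first {c = a ∷ []}                _ = refl
isPattern-max-first {c = a ∷ b ∷ []}            _ = refl
isPattern-max-first {c = a ∷ b ∷ d ∷ e ∷ _}     _ = refl

isPattern-max-second : ∀ {x y c} → All (_< y) c → isPattern (x ∷ y ∷ c) ≡ false
isPattern-max-second {x} {y} {c = a ∷ b ∷ []} (a<y ∷ b<y ∷ [])
  rewrite ≥⇒<ᵇ≡false (<⇒≤ a<y) | ≥⇒<ᵇ≡false (<⇒≤ b<y)
        | ∧-zeroʳ (a <ᵇ y) | ∧-zeroʳ (x <ᵇ a) | ∧-zeroʳ (b <ᵇ y) | ∧-zeroʳ (x <ᵇ b) = refl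
isPattern-max-second {c = []}                _ = refl
isPattern-max-second {c = a ∷ []}            _ = refl
isPattern-max-second {c = a ∷ b ∷ d ∷ _}     _ = refl

isPattern-second≤suc-first : ∀ {x a} c → a ≤ suc x → isPattern (x ∷ a ∷ c) ≡ false
isPattern-second≤suc-first {x} {a} (b ∷ d ∷ []) a≤1+x = cong₂ _∨_ (between b) (between d)
  where
  between : ∀ e {z} → ((x <ᵇ e) ∧ (e <ᵇ a) ∧ z) ≡ false
  between e with <ᵇ-cases x e
  ... | inj₁ (x<e , eq) rewrite eq | ≥⇒<ᵇ≡false {e} {a} (≤-trans a≤1+x x<e) = refl
  ... | inj₂ (_ , eq) rewrite eq = refl
isPattern-second≤suc-first []              _ = refl
isPattern-second≤suc-first (b ∷ [])        _ = refl
isPattern-second≤suc-first (b ∷ d ∷ e ∷ _) _ = refl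

suc-<ᵇ : ∀ {x e} → suc x ≢ e → (suc x <ᵇ e) ≡ (x <ᵇ e)
suc-<ᵇ {x} {e} ≢e with <ᵇ-cases (suc x) e | <ᵇ-cases x e
... | inj₁ (_ , p) | inj₁ (_ , q) = trans p (sym q)
... | inj₂ (_ , p) | inj₂ (_ , q) = trans p (sym q)
... | inj₁ (l , _) | inj₂ (m , _) = ⊥-elim (<-irrefl refl (<-≤-trans l (≤-trans m (n≤1+n x))))
... | inj₂ (l , _) | inj₁ (m , _) = ⊥-elim (≢e (≤-antisym m l))

isPattern-suc-head : ∀ {x} c → All (suc x ≢_) c → isPattern (suc x ∷ c) ≡ isPattern (x ∷ c)
isPattern-suc-head (a ∷ b ∷ d ∷ []) (_ ∷ b≢ ∷ d≢ ∷ []) rewrite suc-<ᵇ b≢ | suc-<ᵇ d≢ = refl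
isPattern-suc-head []                  _ = refl
isPattern-suc-head (a ∷ [])            _ = refl
isPattern-suc-head (a ∷ b ∷ [])        _ = refl
isPattern-suc-head (a ∷ b ∷ d ∷ e ∷ _) _ = refl

isPattern-lower-head : ∀ {x′ x} c → x′ ≤ x → T (isPattern (x ∷ c)) → T (isPattern (x′ ∷ c))
isPattern-lower-head {x′} {x} (a ∷ b ∷ d ∷ []) x′≤x =
  Equivalence.from T-∨ ∘ Sum.map (lower {b}) (lower {d}) ∘ Equivalence.to T-∨
  where
  lower : ∀ {e r} → T ((x <ᵇ e) ∧ r) → T ((x′ <ᵇ e) ∧ r)
  lower {e} t with Equivalence.to T-∧ t
  ... | x<e , r = Equivalence.from T-∧ (<⇒<ᵇ (≤-<-trans x′≤x (<ᵇ⇒< x e x<e)) , r)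
isPattern-lower-head []                  _ ()
isPattern-lower-head (a ∷ [])            _ ()
isPattern-lower-head (a ∷ b ∷ [])        _ ()
isPattern-lower-head (a ∷ b ∷ d ∷ e ∷ _) _ ()

isPattern-1324 : ∀ {x u y v} → x < u → u < y → y < v → T (isPattern (x ∷ y ∷ u ∷ v ∷ []))
isPattern-1324 x<u u<y y<v =
  Equivalence.from T-∨ (inj₁ (Equivalence.from T-∧ (<⇒<ᵇ x<u , Equivalence.from T-∧ (<⇒<ᵇ u<y , <⇒<ᵇ y<v))))

isPattern-1342 : ∀ {x u y v} → x < u → u < y → y < v → T (isPattern (x ∷ y ∷ v ∷ u ∷ []))
isPattern-1342 x<u u<y y<v =
  Equivalence.from T-∨ (inj₂ (Equivalence.from T-∧ (<⇒<ᵇ x<u , Equivalence.from T-∧ (<⇒<ᵇ u<y , <⇒<ᵇ y<v))))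

any-++ : ∀ (p : A → Bool) xs ys → any p (xs ++ ys) ≡ any p xs ∨ any p ys
any-++ p []       ys = refl
any-++ p (x ∷ xs) ys = trans (cong (p x ∨_) (any-++ p xs ys)) (sym (∨-assoc (p x) (any p xs) (any p ys)))

any-map : ∀ (p : B → Bool) (f : A → B) xs → any p (map f xs) ≡ any (p ∘ f) xs
any-map p f []       = refl
any-map p f (x ∷ xs) = cong (p (f x) ∨_) (any-map p f xs)

any-cong : ∀ {p q : A → Bool} xs → (∀ {x} → x ∈ xs → p x ≡ q x) → any p xs ≡ any q xs
any-cong []       eq = refl
any-cong (x ∷ xs) eq = cong₂ _∨_ (eq (here refl)) (any-cong xs (eq ∘ there))

any-≡false : ∀ {p : A → Bool} xs → (∀ {x} → x ∈ xs → p x ≡ false) → any p xs ≡ false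
any-≡false []       _  = refl
any-≡false (x ∷ xs) eq rewrite eq (here refl) = any-≡false xs (eq ∘ there)

any-∨ : ∀ (p q : A → Bool) xs → any p xs ∨ any q xs ≡ any (λ c → p c ∨ q c) xs
any-∨ p q []       = refl
any-∨ p q (x ∷ xs) = trans (interchange (p x) (q x) (any p xs) (any q xs)) (cong ((p x ∨ q x) ∨_) (any-∨ p q xs))
  where
  interchange : ∀ a b c d → (a ∨ c) ∨ (b ∨ d) ≡ (a ∨ b) ∨ (c ∨ d)
  interchange true  b     c d = refl
  interchange false true  c d = ∨-zeroʳ c
  interchange false false c d = refl

T-∨ˡ : ∀ {a b} → T a → T (a ∨ b)
T-∨ˡ = Equivalence.from T-∨ ∘ inj₁

T-∨ʳ : ∀ {a b} → T b → T (a ∨ b)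
T-∨ʳ = Equivalence.from T-∨ ∘ inj₂

∈-choose⁻ : ∀ k xs {c e} → c ∈ choose k xs → e ∈ c → e ∈ xs
∈-choose⁻ zero    xs       (here refl) ()
∈-choose⁻ (suc k) (x ∷ xs) c∈ e∈c with ∈-++⁻ (map (x ∷_) (choose k xs)) c∈
... | inj₂ c∈′ = there (∈-choose⁻ (suc k) xs c∈′ e∈c)
... | inj₁ c∈′ with ∈-map⁻ (x ∷_) c∈′
...   | c′ , c′∈ , refl with e∈c
...     | here refl = here refl
...     | there e∈c′ = there (∈-choose⁻ k xs c′∈ e∈c′)

choose-All : ∀ {Q : ℕ → Set} k {xs c} → All Q xs → c ∈ choose k xs → All Q c
choose-All k {xs} qs c∈ = All.tabulate (All.lookup qs ∘ ∈-choose⁻ k xs c∈)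

choose-map : ∀ (f : ℕ → ℕ) k xs → choose k (map f xs) ≡ map (map f) (choose k xs)
choose-map f zero    xs       = refl
choose-map f (suc k) []       = refl
choose-map f (suc k) (x ∷ xs) = begin
  map (f x ∷_) (choose k (map f xs)) ++ choose (suc k) (map f xs)
    ≡⟨ cong₂ (λ l r → map (f x ∷_) l ++ r) (choose-map f k xs) (choose-map f (suc k) xs) ⟩
  map (f x ∷_) (map (map f) (choose k xs)) ++ map (map f) (choose (suc k) xs)
    ≡⟨ cong (_++ _) (trans (sym (map-∘ (choose k xs))) (map-∘ (choose k xs))) ⟩
  map (map f) (map (x ∷_) (choose k xs)) ++ map (map f) (choose (suc k) xs)
    ≡⟨ sym (map-++ (map f) (map (x ∷_) (choose k xs)) (choose (suc k) xs)) ⟩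
  map (map f) (map (x ∷_) (choose k xs) ++ choose (suc k) xs) ∎
  where open ≡-Reasoning

choose-skip : ∀ k y xs {c} → c ∈ choose k xs → c ∈ choose k (y ∷ xs)
choose-skip zero    y xs c∈ = c∈
choose-skip (suc k) y xs c∈ = ∈-++⁺ʳ (map (y ∷_) (choose k xs)) c∈

choose-keep : ∀ k x xs {c} → c ∈ choose k xs → (x ∷ c) ∈ choose (suc k) (x ∷ xs)
choose-keep k x xs c∈ = ∈-++⁺ˡ (∈-map⁺ (x ∷_) c∈)

choose-single : ∀ {v xs} → v ∈ xs → (v ∷ []) ∈ choose 1 xs
choose-single {xs = x ∷ xs} (here refl) = choose-keep 0 x xs (here refl)
choose-single {xs = x ∷ xs} (there v∈)  = choose-skip 1 x xs (choose-single v∈)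

choose-pair : ∀ {u v xs} → u ∈ xs → v ∈ xs → u ≢ v →
              (u ∷ v ∷ []) ∈ choose 2 xs ⊎ (v ∷ u ∷ []) ∈ choose 2 xs
choose-pair {xs = x ∷ xs} (here refl) (here refl) u≢v = ⊥-elim (u≢v refl)
choose-pair {xs = x ∷ xs} (here refl) (there v∈)  _   = inj₁ (choose-keep 1 x xs (choose-single v∈))
choose-pair {xs = x ∷ xs} (there u∈)  (here refl) _   = inj₂ (choose-keep 1 x xs (choose-single u∈))
choose-pair {xs = x ∷ xs} (there u∈)  (there v∈) u≢v =
  Sum.map (choose-skip 2 x xs) (choose-skip 2 x xs) (choose-pair u∈ v∈ u≢v)

hasPattern : List ℕ → Bool
hasPattern π = any isPattern (choose 4 π)

startsPattern : ℕ → List ℕ → Bool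
startsPattern x xs = any (isPattern ∘ (x ∷_)) (choose 3 xs)

contains⇔hasPattern : ∀ π → (contains1324 π ∨ contains1342 π) ≡ hasPattern π
contains⇔hasPattern π = any-∨ is1324 is1342 (choose 4 π)

hasPattern-∷ : ∀ x xs → hasPattern (x ∷ xs) ≡ startsPattern x xs ∨ hasPattern xs
hasPattern-∷ x xs = trans (any-++ isPattern (map (x ∷_) (choose 3 xs)) (choose 4 xs))
                          (cong (_∨ hasPattern xs) (any-map isPattern (x ∷_) (choose 3 xs)))

startsPattern-∷ : ∀ x y xs →
  startsPattern x (y ∷ xs) ≡ any (λ c → isPattern (x ∷ y ∷ c)) (choose 2 xs) ∨ startsPattern x xs
startsPattern-∷ x y xs = trans (any-++ (isPattern ∘ (x ∷_)) (map (y ∷_) (choose 2 xs)) (choose 3 xs))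
                               (cong (_∨ startsPattern x xs) (any-map (isPattern ∘ (x ∷_)) (y ∷_) (choose 2 xs)))

startsPattern-skip : ∀ x y xs → (∀ {c} → c ∈ choose 2 xs → isPattern (x ∷ y ∷ c) ≡ false) →
                     startsPattern x (y ∷ xs) ≡ startsPattern x xs
startsPattern-skip x y xs never =
  trans (startsPattern-∷ x y xs) (cong (_∨ startsPattern x xs) (any-≡false (choose 2 xs) never))

startsPattern-max : ∀ y xs → All (_< y) xs → startsPattern y xs ≡ false
startsPattern-max y xs <y = any-≡false (choose 3 xs) (isPattern-max-first ∘ choose-All 3 <y)

startsPattern-suc : ∀ x xs → suc x ∉ xs → startsPattern (suc x) xs ≡ startsPattern x xs
startsPattern-suc x xs x+1∉ =
  any-cong (choose 3 xs) (λ {c} c∈ → isPattern-suc-head c (choose-All 3 (¬Any⇒All¬ xs x+1∉) c∈))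

startsPattern-lower : ∀ {x′ x} xs → x′ ≤ x → T (startsPattern x xs) → T (startsPattern x′ xs)
startsPattern-lower {x′} {x} xs x′≤x =
  any⁺ _ ∘ Any.map (λ {c} → isPattern-lower-head c x′≤x) ∘ any⁻ _ (choose 3 xs)

hasPattern-map : ∀ (f : ℕ → ℕ) → (∀ u v → (f u <ᵇ f v) ≡ (u <ᵇ v)) →
                 ∀ xs → hasPattern (map f xs) ≡ hasPattern xs
hasPattern-map f mono xs = begin
  any isPattern (choose 4 (map f xs))        ≡⟨ cong (any isPattern) (choose-map f 4 xs) ⟩
  any isPattern (map (map f) (choose 4 xs))  ≡⟨ any-map isPattern (map f) (choose 4 xs) ⟩
  any (isPattern ∘ map f) (choose 4 xs)      ≡⟨ any-cong (choose 4 xs) (λ {c} _ → isPattern-map f mono c) ⟩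
  any isPattern (choose 4 xs)                ∎
  where open ≡-Reasoning

hasPattern-max-head : ∀ y xs → All (_< y) xs → hasPattern (y ∷ xs) ≡ hasPattern xs
hasPattern-max-head y xs <y = trans (hasPattern-∷ y xs) (cong (_∨ hasPattern xs) (startsPattern-max y xs <y))

hasPattern-max-second : ∀ x y xs → All (_< y) xs → hasPattern (x ∷ y ∷ xs) ≡ hasPattern (x ∷ xs)
hasPattern-max-second x y xs <y = begin
  hasPattern (x ∷ y ∷ xs)                  ≡⟨ hasPattern-∷ x (y ∷ xs) ⟩
  startsPattern x (y ∷ xs) ∨ hasPattern (y ∷ xs)
    ≡⟨ cong₂ _∨_ (startsPattern-skip x y xs (isPattern-max-second ∘ choose-All 2 <y)) (hasPattern-max-head y xs <y) ⟩
  startsPattern x xs ∨ hasPattern xs       ≡⟨ sym (hasPattern-∷ x xs) ⟩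
  hasPattern (x ∷ xs)                      ∎
  where open ≡-Reasoning

hasPattern-suc-second : ∀ x xs → suc x ∉ xs → hasPattern (x ∷ suc x ∷ xs) ≡ hasPattern (x ∷ xs)
hasPattern-suc-second x xs x+1∉ = begin
  hasPattern (x ∷ suc x ∷ xs)
    ≡⟨ trans (hasPattern-∷ x (suc x ∷ xs)) (cong (startsPattern x (suc x ∷ xs) ∨_) (hasPattern-∷ (suc x) xs)) ⟩
  startsPattern x (suc x ∷ xs) ∨ (startsPattern (suc x) xs ∨ hasPattern xs)
    ≡⟨ cong₂ (λ a b → a ∨ (b ∨ hasPattern xs))
         (startsPattern-skip x (suc x) xs (λ {c} _ → isPattern-second≤suc-first c ≤-refl))
         (startsPattern-suc x xs x+1∉) ⟩
  startsPattern x xs ∨ (startsPattern x xs ∨ hasPattern xs)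
    ≡⟨ trans (sym (∨-assoc s s (hasPattern xs))) (cong (_∨ hasPattern xs) (∨-idem s)) ⟩
  startsPattern x xs ∨ hasPattern xs
    ≡⟨ sym (hasPattern-∷ x xs) ⟩
  hasPattern (x ∷ xs) ∎
  where
  open ≡-Reasoning
  s = startsPattern x xs

hasPattern-∷⁺ : ∀ y xs → T (hasPattern xs) → T (hasPattern (y ∷ xs))
hasPattern-∷⁺ y xs = subst T (sym (hasPattern-∷ y xs)) ∘ T-∨ʳ

hasPattern-forced : ∀ {x u y v} ρ → x < u → u < y → y < v → u ∈ ρ → v ∈ ρ → T (hasPattern (x ∷ y ∷ ρ))
hasPattern-forced {x} {u} {y} {v} ρ x<u u<y y<v u∈ v∈
  with choose-pair u∈ v∈ (λ u≡v → <-irrefl u≡v (<-trans u<y y<v))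
... | inj₁ uv∈ = any⁺ isPattern (lose (choose-keep 3 x (y ∷ ρ) (choose-keep 2 y ρ uv∈)) (isPattern-1324 x<u u<y y<v))
... | inj₂ vu∈ = any⁺ isPattern (lose (choose-keep 3 x (y ∷ ρ) (choose-keep 2 y ρ vu∈)) (isPattern-1342 x<u u<y y<v))

hasPattern-drop-head : ∀ i t τ → t ∉ τ → t < i ⊎ t ≡ suc i →
                       T (hasPattern (i ∷ t ∷ τ)) → T (hasPattern (t ∷ τ))
hasPattern-drop-head i t τ t∉ t-cases h with Equivalence.to T-∨ (subst T (hasPattern-∷ i (t ∷ τ)) h)
... | inj₂ rest = rest
... | inj₁ s    = subst T (sym (hasPattern-∷ t τ)) (T-∨ˡ (move t-cases (subst T (startsPattern-skip i t τ second≤) s)))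
  where
  second≤ : ∀ {c} → c ∈ choose 2 τ → isPattern (i ∷ t ∷ c) ≡ false
  second≤ {c} _ = isPattern-second≤suc-first c ([ (λ t<i → ≤-trans (<⇒≤ t<i) (n≤1+n i)) , ≤-reflexive ] t-cases)
  move : t < i ⊎ t ≡ suc i → T (startsPattern i τ) → T (startsPattern t τ)
  move (inj₁ t<i)  = startsPattern-lower τ (<⇒≤ t<i)
  move (inj₂ refl) = subst T (sym (startsPattern-suc i τ t∉))

InRange : ℕ → List ℕ → Set
InRange n π = ∀ {e} → e ∈ π → 0 < e × e ≤ n

IsPermutation : ℕ → List ℕ → Set
IsPermutation n π = length π ≡ n × InRange n π × Unique π

∈-range⁺ : ∀ {n x} → 0 < x → x ≤ n → x ∈ range n
∈-range⁺ {x = suc y} _ x≤n = ∈-map⁺ suc (∈-upTo⁺ x≤n)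

∈-range⁻ : ∀ {n x} → x ∈ range n → 0 < x × x ≤ n
∈-range⁻ x∈ with ∈-map⁻ suc x∈
... | _ , y∈ , refl = s≤s z≤n , ∈-upTo⁻ y∈

range-unique : ∀ n → Unique (range n)
range-unique n = Unique.map⁺ suc-injective (Unique.upTo⁺ n)

concatMap-map≡cartesianProductWith : ∀ (f : A → B → B) xs ys →
  concatMap (λ x → map (f x) ys) xs ≡ cartesianProductWith f xs ys
concatMap-map≡cartesianProductWith f []       ys = refl
concatMap-map≡cartesianProductWith f (x ∷ xs) ys = cong (map (f x) ys ++_) (concatMap-map≡cartesianProductWith f xs ys)

words-suc : ∀ n k → words n (suc k) ≡ cartesianProductWith _∷_ (range n) (words n k)
words-suc n k = concatMap-map≡cartesianProductWith _∷_ (range n) (words n k)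

∈-words⁻ : ∀ n k {π} → π ∈ words n k → length π ≡ k × InRange n π
∈-words⁻ n zero    (here refl) = refl , λ ()
∈-words⁻ n (suc k) π∈ with ∈-cartesianProductWith⁻ _∷_ (range n) (words n k) (subst (_ ∈_) (words-suc n k) π∈)
... | x , w , x∈ , w∈ , refl = cong suc (proj₁ (∈-words⁻ n k w∈)) , inRange
  where
  inRange : InRange n (x ∷ w)
  inRange (here refl) = ∈-range⁻ x∈
  inRange (there e∈)  = proj₂ (∈-words⁻ n k w∈) e∈

∈-words⁺ : ∀ n k {π} → length π ≡ k → InRange n π → π ∈ words n k
∈-words⁺ n zero    {[]}    _   _       = here refl
∈-words⁺ n (suc k) {x ∷ π} len inRange =
  subst (_ ∈_) (sym (words-suc n k))
    (∈-cartesianProductWith⁺ _∷_ (uncurry ∈-range⁺ (inRange (here refl)))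
                                  (∈-words⁺ n k (suc-injective len) (inRange ∘ there)))

words-unique : ∀ n k → Unique (words n k)
words-unique n zero    = [] ∷ []
words-unique n (suc k) = subst Unique (sym (words-suc n k))
  (Unique.cartesianProductWith⁺ _∷_ ∷-injective (range-unique n) (words-unique n k))

T-not-≡ᵇ⇒≢ : ∀ {x y} → T (not (x ≡ᵇ y)) → x ≢ y
T-not-≡ᵇ⇒≢ {x} t refl = subst T (Equivalence.to T-not-≡ t) (≡⇒≡ᵇ x x refl)

≢⇒T-not-≡ᵇ : ∀ {x y} → x ≢ y → T (not (x ≡ᵇ y))
≢⇒T-not-≡ᵇ {x} {y} x≢y with x ≡ᵇ y in eq
... | true  = x≢y (≡ᵇ⇒≡ x y (subst T (sym eq) tt))
... | false = tt

distinct⇒Unique : ∀ π → T (distinct π) → Unique π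
distinct⇒Unique []      _ = []
distinct⇒Unique (x ∷ π) t with Equivalence.to T-∧ t
... | x∉ , rest = All.map T-not-≡ᵇ⇒≢ (all⁺ _ π x∉) ∷ distinct⇒Unique π rest

Unique⇒distinct : ∀ π → Unique π → T (distinct π)
Unique⇒distinct []      _          = tt
Unique⇒distinct (x ∷ π) (x∉ ∷ uπ) =
  Equivalence.from T-∧ (all⁻ _ (All.map ≢⇒T-not-≡ᵇ x∉) , Unique⇒distinct π uπ)

avoids⇔¬hasPattern : ∀ π → T (not (contains1324 π) ∧ not (contains1342 π)) ⇔ (hasPattern π ≡ false)
avoids⇔¬hasPattern π = mk⇔
  (λ t → trans (sym (contains⇔hasPattern π)) (neither⁻ (contains1324 π) (contains1342 π) t))
  (λ h → neither⁺ (contains1324 π) (contains1342 π) (trans (contains⇔hasPattern π) h))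
  where
  neither⁻ : ∀ a b → T (not a ∧ not b) → a ∨ b ≡ false
  neither⁻ false false _ = refl
  neither⁺ : ∀ a b → a ∨ b ≡ false → T (not a ∧ not b)
  neither⁺ false false _ = tt

∈-avoiders⁻ : ∀ n {π} → π ∈ avoiders n → IsPermutation n π × hasPattern π ≡ false
∈-avoiders⁻ n {π} π∈
  with ∈-filter⁻ (λ π → T? (not (contains1324 π) ∧ not (contains1342 π))) {xs = perms n} π∈
... | π∈perms , avoids with ∈-filter⁻ (λ w → T? (distinct w)) {xs = words n n} π∈perms
...   | π∈words , dist with ∈-words⁻ n n π∈words
...     | len , inRange = (len , inRange , distinct⇒Unique π dist) , Equivalence.to (avoids⇔¬hasPattern π) avoids

∈-avoiders⁺ : ∀ n {π} → IsPermutation n π → hasPattern π ≡ false → π ∈ avoiders n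
∈-avoiders⁺ n {π} (len , inRange , uπ) noPattern =
  ∈-filter⁺ (λ π → T? (not (contains1324 π) ∧ not (contains1342 π))) {xs = perms n}
    (∈-filter⁺ (λ w → T? (distinct w)) {xs = words n n} (∈-words⁺ n n len inRange) (Unique⇒distinct π uπ))
    (Equivalence.from (avoids⇔¬hasPattern π) noPattern)

avoiders-unique : ∀ n → Unique (avoiders n)
avoiders-unique n = Unique.filter⁺ _ (Unique.filter⁺ _ (words-unique n n))

remove : ∀ {x : A} ys → x ∈ ys → List A
remove (y ∷ ys) (here _)  = ys
remove (y ∷ ys) (there p) = y ∷ remove ys p

length-remove : ∀ {x : A} ys (p : x ∈ ys) → length ys ≡ suc (length (remove ys p))
length-remove (y ∷ ys) (here _)  = refl
length-remove (y ∷ ys) (there p) = cong suc (length-remove ys p)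

∈-remove : ∀ {x e : A} ys (p : x ∈ ys) → e ∈ ys → e ≢ x → e ∈ remove ys p
∈-remove (y ∷ ys) (here refl) (here refl) e≢x = ⊥-elim (e≢x refl)
∈-remove (y ∷ ys) (here refl) (there e∈)  _   = e∈
∈-remove (y ∷ ys) (there p)   (here refl) _   = here refl
∈-remove (y ∷ ys) (there p)   (there e∈)  e≢x = there (∈-remove ys p e∈ e≢x)

Unique-⊆⇒length≤ : ∀ (xs ys : List A) → Unique xs → (∀ {e} → e ∈ xs → e ∈ ys) → length xs ≤ length ys
Unique-⊆⇒length≤ []       ys _          _   = z≤n
Unique-⊆⇒length≤ (x ∷ xs) ys (x∉ ∷ uxs) sub = begin
  suc (length xs)                ≤⟨ s≤s (Unique-⊆⇒length≤ xs (remove ys x∈) uxs sub′) ⟩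
  suc (length (remove ys x∈))    ≡⟨ sym (length-remove ys x∈) ⟩
  length ys                      ∎
  where
  open ≤-Reasoning
  x∈ = sub (here refl)
  sub′ : ∀ {e} → e ∈ xs → e ∈ remove ys x∈
  sub′ e∈ = ∈-remove ys x∈ (sub (there e∈)) (λ e≡x → All.lookup x∉ e∈ (sym e≡x))

length-range : ∀ n → length (range n) ≡ n
length-range n = trans (length-map suc (upTo n)) (length-upTo n)

IsPermutation-∈ : ∀ {n π v} → IsPermutation n π → 0 < v → v ≤ n → v ∈ π
IsPermutation-∈ {n} {π} {v} (len , inRange , uπ) 0<v v≤n with v ∈? π
... | yes v∈ = v∈
... | no  v∉ = ⊥-elim (<-irrefl refl (begin-strict
  length π                 <⟨ Unique-⊆⇒length≤ (v ∷ π) (range n) (¬Any⇒All¬ π v∉ ∷ uπ) sub ⟩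
  length (range n)         ≡⟨ trans (length-range n) (sym len) ⟩
  length π                 ∎))
  where
  open ≤-Reasoning
  sub : ∀ {e} → e ∈ v ∷ π → e ∈ range n
  sub (here refl) = ∈-range⁺ 0<v v≤n
  sub (there e∈)  = uncurry ∈-range⁺ (inRange e∈)

punchIn : ℕ → ℕ → ℕ
punchIn i v = if v <ᵇ i then v else suc v

punchOut : ℕ → ℕ → ℕ
punchOut i v = if v <ᵇ i then v else pred v

punchIn-< : ∀ {i v} → v < i → punchIn i v ≡ v
punchIn-< v<i rewrite <⇒<ᵇ≡true v<i = refl

punchIn-≥ : ∀ {i v} → i ≤ v → punchIn i v ≡ suc v
punchIn-≥ i≤v rewrite ≥⇒<ᵇ≡false i≤v = refl

punchOut-< : ∀ {i v} → v < i → punchOut i v ≡ v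
punchOut-< v<i rewrite <⇒<ᵇ≡true v<i = refl

punchOut-≥ : ∀ {i v} → i ≤ v → punchOut i v ≡ pred v
punchOut-≥ i≤v rewrite ≥⇒<ᵇ≡false i≤v = refl

punchIn≢ : ∀ i v → i ≢ punchIn i v
punchIn≢ i v with <ᵇ-cases v i
... | inj₁ (v<i , eq) rewrite eq = λ i≡v → <-irrefl (sym i≡v) v<i
... | inj₂ (i≤v , eq) rewrite eq = λ i≡v → <-irrefl i≡v (s≤s i≤v)

≤-punchIn : ∀ i v → v ≤ punchIn i v
≤-punchIn i v with <ᵇ-cases v i
... | inj₁ (_ , eq) rewrite eq = ≤-refl
... | inj₂ (_ , eq) rewrite eq = n≤1+n v

punchIn-≤-suc : ∀ i v → punchIn i v ≤ suc v
punchIn-≤-suc i v with <ᵇ-cases v i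
... | inj₁ (_ , eq) rewrite eq = n≤1+n v
... | inj₂ (_ , eq) rewrite eq = ≤-refl

punchIn-<ᵇ : ∀ i u v → (punchIn i u <ᵇ punchIn i v) ≡ (u <ᵇ v)
punchIn-<ᵇ i u v with <ᵇ-cases u i | <ᵇ-cases v i
... | inj₁ (_ , p) | inj₁ (_ , q) rewrite p | q = refl
... | inj₂ (_ , p) | inj₂ (_ , q) rewrite p | q = refl
... | inj₁ (u<i , p) | inj₂ (i≤v , q) rewrite p | q =
  trans (<⇒<ᵇ≡true (<-≤-trans u<i (m≤n⇒m≤1+n i≤v))) (sym (<⇒<ᵇ≡true (<-≤-trans u<i i≤v)))
... | inj₂ (i≤u , p) | inj₁ (v<i , q) rewrite p | q =
  trans (≥⇒<ᵇ≡false (m≤n⇒m≤1+n (<⇒≤ (<-≤-trans v<i i≤u))))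
        (sym (≥⇒<ᵇ≡false (<⇒≤ (<-≤-trans v<i i≤u))))

punchIn-injective : ∀ i {u v} → punchIn i u ≡ punchIn i v → u ≡ v
punchIn-injective i {u} {v} eq with <ᵇ-cases u i | <ᵇ-cases v i
... | inj₁ (_ , p) | inj₁ (_ , q) rewrite p | q = eq
... | inj₂ (_ , p) | inj₂ (_ , q) rewrite p | q = suc-injective eq
... | inj₁ (u<i , p) | inj₂ (i≤v , q) rewrite p | q = ⊥-elim (<-irrefl eq (<-≤-trans u<i (m≤n⇒m≤1+n i≤v)))
... | inj₂ (i≤u , p) | inj₁ (v<i , q) rewrite p | q = ⊥-elim (<-irrefl (sym eq) (<-≤-trans v<i (m≤n⇒m≤1+n i≤u)))

punchIn-punchOut : ∀ {i v} → i ≢ v → punchIn i (punchOut i v) ≡ v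
punchIn-punchOut {i} {v} i≢v with <ᵇ-cases v i
... | inj₁ (_ , eq) rewrite eq | eq = refl
punchIn-punchOut {i} {zero}  i≢v | inj₂ (i≤0 , _) = ⊥-elim (i≢v (n≤0⇒n≡0 i≤0))
punchIn-punchOut {i} {suc w} i≢v | inj₂ (i≤v , eq)
  rewrite eq | ≥⇒<ᵇ≡false {w} {i} (≤-pred (≤∧≢⇒< i≤v i≢v)) = refl

map-punchIn-punchOut : ∀ i τ → All (i ≢_) τ → map (punchIn i) (map (punchOut i) τ) ≡ τ
map-punchIn-punchOut i τ i∉ = trans (sym (map-∘ τ)) (map-id-local (All.map punchIn-punchOut i∉))

IsPermutation-swap : ∀ {n x y τ} → IsPermutation n (x ∷ y ∷ τ) → IsPermutation n (y ∷ x ∷ τ)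
IsPermutation-swap (len , inRange , (x∉ ∷ y∉ ∷ uτ)) =
  len , inRange′ , ((≢-sym (All.head x∉) ∷ y∉) ∷ All.tail x∉ ∷ uτ)
  where
  inRange′ : InRange _ _
  inRange′ (here refl)         = inRange (there (here refl))
  inRange′ (there (here refl)) = inRange (here refl)
  inRange′ (there (there e∈))  = inRange (there (there e∈))

IsPermutation-punchIn : ∀ {n x σ} → IsPermutation n σ → 0 < x → x ≤ suc n →
                        IsPermutation (suc n) (x ∷ map (punchIn x) σ)
IsPermutation-punchIn {n} {x} {σ} (len , inRange , uσ) 0<x x≤1+n =
  cong suc (trans (length-map (punchIn x) σ) len) , inRange′ ,
  (All.tabulate x∉ ∷ Unique.map⁺ (punchIn-injective x) uσ)
  where
  inRange′ : InRange (suc n) (x ∷ map (punchIn x) σ)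
  inRange′ (here refl) = 0<x , x≤1+n
  inRange′ (there e∈) with ∈-map⁻ (punchIn x) e∈
  ... | e , e∈σ , refl = <-≤-trans (proj₁ (inRange e∈σ)) (≤-punchIn x e) ,
                         ≤-trans (punchIn-≤-suc x e) (s≤s (proj₂ (inRange e∈σ)))
  x∉ : ∀ {v} → v ∈ map (punchIn x) σ → x ≢ v
  x∉ v∈ with ∈-map⁻ (punchIn x) v∈
  ... | e , _ , refl = punchIn≢ x e

IsPermutation-punchOut : ∀ {n x τ} → IsPermutation (suc n) (x ∷ τ) → IsPermutation n (map (punchOut x) τ)
IsPermutation-punchOut {n} {x} {τ} (len , inRange , (x∉ ∷ uτ)) =
  trans (length-map (punchOut x) τ) (suc-injective len) , inRange′ ,
  Unique.map⁻ (subst Unique (sym (map-punchIn-punchOut x τ x∉)) uτ)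
  where
  bounds : ∀ {e} → e ∈ τ → 0 < punchOut x e × punchOut x e ≤ n
  bounds {e} e∈ with inRange (there e∈) | <ᵇ-cases e x
  ... | 0<e , e≤1+n | inj₁ (e<x , _) rewrite punchOut-< e<x =
    0<e , ≤-pred (<-≤-trans e<x (proj₂ (inRange (here refl))))
  ... | _ , e≤1+n | inj₂ (x≤e , _) rewrite punchOut-≥ x≤e =
    ≤-trans (proj₁ (inRange (here refl))) (pred-mono-≤ (≤∧≢⇒< x≤e (All.lookup x∉ e∈))) , pred-mono-≤ e≤1+n
  inRange′ : InRange n (map (punchOut x) τ)
  inRange′ e∈ with ∈-map⁻ (punchOut x) e∈
  ... | e , e∈τ , refl = bounds e∈τ

IsPermutation-max : ∀ {n τ} → IsPermutation (suc n) (suc n ∷ τ) → All (_< suc n) τ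
IsPermutation-max (_ , inRange , (n∉ ∷ _)) =
  All.tabulate (λ e∈ → ≤∧≢⇒< (proj₂ (inRange (there e∈))) (≢-sym (All.lookup n∉ e∈)))

IsPermutation-drop-max : ∀ {n τ} → IsPermutation (suc n) (suc n ∷ τ) → IsPermutation n τ
IsPermutation-drop-max {n} {τ} p = subst (IsPermutation n) (map-id-local (All.map punchOut-< (IsPermutation-max p)))
                                         (IsPermutation-punchOut p)

IsPermutation-add-max : ∀ {n σ} → IsPermutation n σ → IsPermutation (suc n) (suc n ∷ σ)
IsPermutation-add-max {n} {σ} p@(_ , inRange , _) =
  subst (λ σ′ → IsPermutation (suc n) (suc n ∷ σ′))
        (map-id-local (All.tabulate (punchIn-< ∘ s≤s ∘ proj₂ ∘ inRange)))
        (IsPermutation-punchIn p (s≤s z≤n) ≤-refl)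

headIs : ℕ → List ℕ → Bool
headIs j []      = false
headIs j (x ∷ _) = x ≡ᵇ j

headLe : ℕ → List ℕ → Bool
headLe b []      = false
headLe b (x ∷ _) = x <ᵇ suc b

avoidersWith : (List ℕ → Bool) → ℕ → List (List ℕ)
avoidersWith p n = filter (λ π → T? (p π)) (avoiders n)

∈-avoidersWith⁻ : ∀ p n {π} → π ∈ avoidersWith p n → IsPermutation n π × hasPattern π ≡ false × T (p π)
∈-avoidersWith⁻ p n π∈ with ∈-filter⁻ (λ π → T? (p π)) {xs = avoiders n} π∈
... | π∈avoiders , pπ = let (perm , noPattern) = ∈-avoiders⁻ n π∈avoiders in perm , noPattern , pπ

∈-avoidersWith⁺ : ∀ p n {π} → IsPermutation n π → hasPattern π ≡ false → T (p π) → π ∈ avoidersWith p n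
∈-avoidersWith⁺ p n perm noPattern pπ =
  ∈-filter⁺ (λ π → T? (p π)) {xs = avoiders n} (∈-avoiders⁺ n perm noPattern) pπ

avoidersWith-unique : ∀ p n → Unique (avoidersWith p n)
avoidersWith-unique p n = Unique.filter⁺ (λ π → T? (p π)) (avoiders-unique n)

startsWith⁻ : ∀ i j π → T (startsWith i j π) → ∃ λ ρ → π ≡ i ∷ j ∷ ρ
startsWith⁻ i j (x ∷ y ∷ ρ) t with Equivalence.to T-∧ t
... | x≡i , y≡j = ρ , cong₂ (λ u v → u ∷ v ∷ ρ) (≡ᵇ⇒≡ x i x≡i) (≡ᵇ⇒≡ y j y≡j)

startsWith⁺ : ∀ i j ρ → T (startsWith i j (i ∷ j ∷ ρ))
startsWith⁺ i j ρ = Equivalence.from T-∧ (≡⇒≡ᵇ i i refl , ≡⇒≡ᵇ j j refl)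

headIs⁻ : ∀ j π → T (headIs j π) → ∃ λ ρ → π ≡ j ∷ ρ
headIs⁻ j (x ∷ ρ) t = ρ , cong (_∷ ρ) (≡ᵇ⇒≡ x j t)

unique-⊆-⊇⇒↭ : ∀ {xs ys : List A} → Unique xs → Unique ys →
               (∀ {z} → z ∈ xs → z ∈ ys) → (∀ {z} → z ∈ ys → z ∈ xs) → xs ↭ ys
unique-⊆-⊇⇒↭ uxs uys ⊆ ⊇ = ∼bag⇒↭ (unique∧set⇒bag uxs uys (mk⇔ ⊆ ⊇))

≡false-by : ∀ {a b : Bool} → (T a → T b) → b ≡ false → a ≡ false
≡false-by {false} _   _    = refl
≡false-by {true}  a⇒b refl = ⊥-elim (a⇒b tt)

insertSecond : ℕ → List ℕ → List ℕ
insertSecond y []       = y ∷ []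
insertSecond y (x ∷ xs) = x ∷ y ∷ xs

insertSecond-injective : ∀ y {xs ys} → insertSecond y xs ≡ insertSecond y ys → xs ≡ ys
insertSecond-injective y {[]}     {[]}     _    = refl
insertSecond-injective y {x ∷ xs} {x′ ∷ ys} refl = refl
insertSecond-injective y {[]}     {_ ∷ []} ()
insertSecond-injective y {[]}     {_ ∷ _ ∷ _} ()
insertSecond-injective y {_ ∷ []} {[]}     ()
insertSecond-injective y {_ ∷ _ ∷ _} {[]}  ()

∈-drop₂ : ∀ {v x y : ℕ} {ρ} → v ∈ x ∷ y ∷ ρ → v ≢ x → v ≢ y → v ∈ ρ
∈-drop₂ (here refl)         v≢x _   = ⊥-elim (v≢x refl)
∈-drop₂ (there (here refl)) _   v≢y = ⊥-elim (v≢y refl)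
∈-drop₂ (there (there v∈))  _   _   = v∈

desc-map : ∀ (f : ℕ → ℕ) → (∀ u v → (f u <ᵇ f v) ≡ (u <ᵇ v)) → ∀ xs → desc (map f xs) ≡ desc xs
desc-map f mono []           = refl
desc-map f mono (x ∷ [])     = refl
desc-map f mono (x ∷ y ∷ zs) = cong₂ Nat._+_ (cong (if_then 1 else 0) (mono y x)) (desc-map f mono (y ∷ zs))

prependWithMax : ℕ → ℕ → List ℕ → List ℕ
prependWithMax i n σ = i ∷ n ∷ map (punchIn i) σ

module MaxSecond (m i : ℕ) (0<i : 0 < i) (i≤1+m : i ≤ suc m) where

  N₁ N b : ℕ
  N₁ = suc (suc m)
  N  = suc N₁
  b  = i ⊓ m

  lhs maxThird lowHead rhs : List (List ℕ)
  lhs      = avoidersWith (startsWith i N) N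
  maxThird = avoidersWith (startsWith i N₁) N₁
  lowHead  = avoidersWith (headLe b) (suc m)
  rhs      = map (insertSecond N) maxThird ++ map (prependWithMax i N) lowHead

  i<N₁ : i < N₁
  i<N₁ = s≤s i≤1+m

  insertN-perm : ∀ {τ} → IsPermutation N₁ (i ∷ τ) → IsPermutation N (i ∷ N ∷ τ)
  insertN-perm = IsPermutation-swap ∘ IsPermutation-add-max

  deleteN-perm : ∀ {τ} → IsPermutation N (i ∷ N ∷ τ) → IsPermutation N₁ (i ∷ τ)
  deleteN-perm = IsPermutation-drop-max ∘ IsPermutation-swap

  deleteN-hasPattern : ∀ {τ} → IsPermutation N (i ∷ N ∷ τ) → hasPattern (i ∷ N ∷ τ) ≡ hasPattern (i ∷ τ)
  deleteN-hasPattern {τ} perm = hasPattern-max-second i N τ (All.tail (IsPermutation-max (IsPermutation-swap perm)))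

  third≤suc-first : ∀ t ρ → IsPermutation N₁ (i ∷ t ∷ ρ) → hasPattern (i ∷ t ∷ ρ) ≡ false →
                    t ≢ N₁ → t ≤ suc i
  third≤suc-first t ρ perm@(_ , inRange , _) noPattern t≢N₁ with <ᵇ-cases (suc i) t
  ... | inj₂ (t≤1+i , _) = t≤1+i
  ... | inj₁ (1+i<t , _) = ⊥-elim (subst T noPattern (hasPattern-forced ρ (n<1+n i) 1+i<t t<N₁ 1+i∈ N₁∈))
    where
    t<N₁ = ≤∧≢⇒< (proj₂ (inRange (there (here refl)))) t≢N₁
    1+i∈ = ∈-drop₂ (IsPermutation-∈ perm (s≤s z≤n) i<N₁)
             (λ eq → <-irrefl (sym eq) (n<1+n i)) (λ eq → <-irrefl eq 1+i<t)
    N₁∈  = ∈-drop₂ (IsPermutation-∈ perm (s≤s z≤n) ≤-refl) (λ eq → <-irrefl (sym eq) i<N₁) (≢-sym t≢N₁)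

  punchOut-third≤b : ∀ t → i ≢ t → t ≢ N₁ → t ≤ suc i → punchOut i t ≤ b
  punchOut-third≤b t i≢t t≢N₁ t≤1+i with <ᵇ-cases t i
  ... | inj₁ (t<i , _) rewrite punchOut-< t<i = ⊓-glb (<⇒≤ t<i) (≤-pred (<-≤-trans t<i i≤1+m))
  ... | inj₂ (i≤t , _) with ≤-antisym t≤1+i (≤∧≢⇒< i≤t i≢t)
  ...   | refl rewrite punchOut-≥ i≤t = ⊓-glb ≤-refl (≤-pred (≤∧≢⇒< i≤1+m (t≢N₁ ∘ cong suc)))

  fromMaxDeleted : ∀ t ρ → IsPermutation N₁ (i ∷ t ∷ ρ) → hasPattern (i ∷ t ∷ ρ) ≡ false →
                   (i ∷ N ∷ t ∷ ρ) ∈ rhs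
  fromMaxDeleted t ρ perm noPattern with t ≟ N₁
  ... | yes refl = ∈-++⁺ˡ (∈-map⁺ (insertSecond N) (∈-avoidersWith⁺ _ N₁ perm noPattern (startsWith⁺ i N₁ ρ)))
  ... | no t≢N₁ =
    ∈-++⁺ʳ (map (insertSecond N) maxThird) (subst (_∈ map (prependWithMax i N) lowHead) π≡ (∈-map⁺ _ σ∈))
    where
    i∉ : All (i ≢_) (t ∷ ρ)
    i∉ = AllPairs.head (proj₂ (proj₂ perm))
    σ = map (punchOut i) (t ∷ ρ)
    π≡ : prependWithMax i N σ ≡ i ∷ N ∷ t ∷ ρ
    π≡ = cong (λ τ → i ∷ N ∷ τ) (map-punchIn-punchOut i (t ∷ ρ) i∉)
    σ-noPattern : hasPattern σ ≡ false
    σ-noPattern = begin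
      hasPattern σ                        ≡⟨ sym (hasPattern-map (punchIn i) (punchIn-<ᵇ i) σ) ⟩
      hasPattern (map (punchIn i) σ)      ≡⟨ cong hasPattern (map-punchIn-punchOut i (t ∷ ρ) i∉) ⟩
      hasPattern (t ∷ ρ)                  ≡⟨ ≡false-by (hasPattern-∷⁺ i (t ∷ ρ)) noPattern ⟩
      false                               ∎
      where open ≡-Reasoning
    σ∈ : σ ∈ lowHead
    σ∈ = ∈-avoidersWith⁺ (headLe b) (suc m) (IsPermutation-punchOut perm) σ-noPattern
           (<⇒<ᵇ (s≤s (punchOut-third≤b t (All.head i∉) t≢N₁ (third≤suc-first t ρ perm noPattern t≢N₁))))

  fromLhs : ∀ {π} → π ∈ lhs → π ∈ rhs
  fromLhs {π} π∈ with ∈-avoidersWith⁻ (startsWith i N) N π∈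
  ... | perm , noPattern , st with startsWith⁻ i N π st
  ...   | []    , refl = ⊥-elim (<-irrefl (proj₁ perm) (s≤s (s≤s (s≤s z≤n))))
  ...   | t ∷ ρ , refl = fromMaxDeleted t ρ (deleteN-perm perm) (trans (sym (deleteN-hasPattern perm)) noPattern)

  fromMaxThird : ∀ {σ} → σ ∈ maxThird → insertSecond N σ ∈ lhs
  fromMaxThird {σ} σ∈ with ∈-avoidersWith⁻ (startsWith i N₁) N₁ σ∈
  ... | perm , noPattern , st with startsWith⁻ i N₁ σ st
  ... | ρ , refl = ∈-avoidersWith⁺ (startsWith i N) N (insertN-perm perm)
                     (trans (deleteN-hasPattern (insertN-perm perm)) noPattern) (startsWith⁺ i N (N₁ ∷ ρ))

  fromLowHead : ∀ {σ} → σ ∈ lowHead → prependWithMax i N σ ∈ lhs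
  fromLowHead {σ} σ∈ with ∈-avoidersWith⁻ (headLe b) (suc m) σ∈
  fromLowHead {[]}     σ∈ | _ , _ , ()
  fromLowHead {h ∷ σ′} σ∈ | perm , noPattern , h<1+b =
    ∈-avoidersWith⁺ (startsWith i N) N (insertN-perm perm₁) π-noPattern (startsWith⁺ i N τ)
    where
    τ = map (punchIn i) (h ∷ σ′)
    perm₁ : IsPermutation N₁ (i ∷ τ)
    perm₁ = IsPermutation-punchIn perm 0<i (m≤n⇒m≤1+n i≤1+m)
    h≤b : h ≤ b
    h≤b = ≤-pred (<ᵇ⇒< h (suc b) h<1+b)
    second-cases : punchIn i h < i ⊎ punchIn i h ≡ suc i
    second-cases with <ᵇ-cases h i
    ... | inj₁ (h<i , _) = inj₁ (subst (_< i) (sym (punchIn-< h<i)) h<i)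
    ... | inj₂ (i≤h , _) = inj₂ (trans (punchIn-≥ i≤h) (cong suc (≤-antisym (≤-trans h≤b (m⊓n≤m i m)) i≤h)))
    second∉ : punchIn i h ∉ map (punchIn i) σ′
    second∉ with proj₂ (proj₂ perm₁)
    ... | _ ∷ (h∉ ∷ _) = All¬⇒¬Any h∉
    π-noPattern : hasPattern (i ∷ N ∷ τ) ≡ false
    π-noPattern = begin
      hasPattern (i ∷ N ∷ τ)   ≡⟨ deleteN-hasPattern (insertN-perm perm₁) ⟩
      hasPattern (i ∷ τ)       ≡⟨ ≡false-by (hasPattern-drop-head i _ _ second∉ second-cases) τ-noPattern ⟩
      false                    ∎
      where
      open ≡-Reasoning
      τ-noPattern = trans (hasPattern-map (punchIn i) (punchIn-<ᵇ i) (h ∷ σ′)) noPattern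

  prependWithMax-injective : ∀ {σ σ′} → prependWithMax i N σ ≡ prependWithMax i N σ′ → σ ≡ σ′
  prependWithMax-injective = map-injective (punchIn-injective i) ∘ ∷-injectiveʳ ∘ ∷-injectiveʳ

  images-disjoint : ∀ {π} → π ∈ map (insertSecond N) maxThird × π ∈ map (prependWithMax i N) lowHead → ⊥
  images-disjoint (π∈₁ , π∈₂) with ∈-map⁻ (insertSecond N) π∈₁ | ∈-map⁻ (prependWithMax i N) π∈₂
  ... | σ , σ∈ , refl | τ , τ∈ , eq with ∈-avoidersWith⁻ _ N₁ σ∈ | ∈-avoidersWith⁻ (headLe b) (suc m) τ∈
  ...   | _ , _ , st | _ , _ , h<1+b with startsWith⁻ i N₁ σ st | τ
  ...     | ρ , refl | []     = h<1+b
  ...     | ρ , refl | h ∷ τ′ = <-irrefl (sym (∷-injectiveˡ (∷-injectiveʳ (∷-injectiveʳ eq)))) (begin-strict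
    punchIn i h  ≤⟨ punchIn-≤-suc i h ⟩
    suc h        ≤⟨ <ᵇ⇒< h (suc b) h<1+b ⟩
    suc b        ≤⟨ s≤s (m⊓n≤n i m) ⟩
    suc m        <⟨ n<1+n (suc m) ⟩
    N₁           ∎)
    where open ≤-Reasoning

  lhs↭rhs : lhs ↭ rhs
  lhs↭rhs = unique-⊆-⊇⇒↭ (avoidersWith-unique _ N) rhs-unique fromLhs toLhs
    where
    rhs-unique : Unique rhs
    rhs-unique = Unique.++⁺ (Unique.map⁺ (insertSecond-injective N) (avoidersWith-unique _ N₁))
                            (Unique.map⁺ prependWithMax-injective (avoidersWith-unique _ (suc m)))
                            images-disjoint
    toLhs : ∀ {π} → π ∈ rhs → π ∈ lhs
    toLhs π∈ with ∈-++⁻ (map (insertSecond N) maxThird) π∈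
    ... | inj₁ π∈₁ with ∈-map⁻ (insertSecond N) π∈₁
    ...   | σ , σ∈ , refl = fromMaxThird σ∈
    toLhs π∈ | inj₂ π∈₂ with ∈-map⁻ (prependWithMax i N) π∈₂
    ...   | σ , σ∈ , refl = fromLowHead σ∈

  desc-insertSecond : ∀ {σ} → σ ∈ maxThird → desc (insertSecond N σ) ≡ suc (desc σ)
  desc-insertSecond {σ} σ∈ with ∈-avoidersWith⁻ (startsWith i N₁) N₁ σ∈
  ... | _ , _ , st with startsWith⁻ i N₁ σ st
  ... | ρ , refl rewrite ≥⇒<ᵇ≡false {N} {i} (m≤n⇒m≤1+n (<⇒≤ i<N₁))
                       | ≥⇒<ᵇ≡false {N₁} {i} (<⇒≤ i<N₁)
                       | <⇒<ᵇ≡true (n<1+n N₁) = refl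

  desc-prependWithMax : ∀ {σ} → σ ∈ lowHead → desc (prependWithMax i N σ) ≡ suc (desc σ)
  desc-prependWithMax {σ} σ∈ with ∈-avoidersWith⁻ (headLe b) (suc m) σ∈
  desc-prependWithMax {[]}     σ∈ | _ , _ , ()
  desc-prependWithMax {h ∷ σ′} σ∈ | (_ , inRange , _) , _ , _
    rewrite ≥⇒<ᵇ≡false {N} {i} (m≤n⇒m≤1+n (<⇒≤ i<N₁))
          | <⇒<ᵇ≡true {punchIn i h} {N} (s≤s (≤-trans (punchIn-≤-suc i h) (s≤s (proj₂ (inRange (here refl))))))
          = cong suc (desc-map (punchIn i) (punchIn-<ᵇ i) (h ∷ σ′))

inflateHead : ℕ → List ℕ → List ℕ
inflateHead i σ = insertSecond (suc i) (map (punchIn (suc i)) σ)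

module ConsecutiveStart (n i : ℕ) (0<i : 0 < i) (i≤n : i ≤ n) where

  lhs rhs : List (List ℕ)
  lhs = avoidersWith (startsWith i (suc i)) (suc n)
  rhs = map (inflateHead i) (avoidersWith (headIs i) n)

  punchIn-i : punchIn (suc i) i ≡ i
  punchIn-i = punchIn-< (n<1+n i)

  fromLhs : ∀ {π} → π ∈ lhs → π ∈ rhs
  fromLhs {π} π∈ with ∈-avoidersWith⁻ (startsWith i (suc i)) (suc n) π∈
  ... | perm , noPattern , st with startsWith⁻ i (suc i) π st
  ... | τ , refl = subst (_∈ rhs) π≡ (∈-map⁺ (inflateHead i) σ∈)
    where
    1+i∉ : All (suc i ≢_) (i ∷ τ)
    1+i∉ = AllPairs.head (proj₂ (proj₂ (IsPermutation-swap perm)))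
    σ = map (punchOut (suc i)) (i ∷ τ)
    unσ : map (punchIn (suc i)) σ ≡ i ∷ τ
    unσ = map-punchIn-punchOut (suc i) (i ∷ τ) 1+i∉
    π≡ : inflateHead i σ ≡ i ∷ suc i ∷ τ
    π≡ = cong (insertSecond (suc i)) unσ
    σ-noPattern : hasPattern σ ≡ false
    σ-noPattern = begin
      hasPattern σ                         ≡⟨ sym (hasPattern-map (punchIn (suc i)) (punchIn-<ᵇ (suc i)) σ) ⟩
      hasPattern (map (punchIn (suc i)) σ) ≡⟨ cong hasPattern unσ ⟩
      hasPattern (i ∷ τ)                   ≡⟨ sym (hasPattern-suc-second i τ (All¬⇒¬Any (All.tail 1+i∉))) ⟩
      hasPattern (i ∷ suc i ∷ τ)           ≡⟨ noPattern ⟩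
      false                                ∎
      where open ≡-Reasoning
    σ∈ : σ ∈ avoidersWith (headIs i) n
    σ∈ = ∈-avoidersWith⁺ (headIs i) n (IsPermutation-punchOut (IsPermutation-swap perm)) σ-noPattern
           (subst (λ x → T (x ≡ᵇ i)) (sym (punchOut-< (n<1+n i))) (≡⇒≡ᵇ i i refl))

  fromRhs : ∀ {π} → π ∈ rhs → π ∈ lhs
  fromRhs {π} π∈ with ∈-map⁻ (inflateHead i) π∈
  ... | σ , σ∈ , refl with ∈-avoidersWith⁻ (headIs i) n σ∈
  ... | perm , noPattern , hd with headIs⁻ i σ hd
  ... | ρ , refl = ∈-avoidersWith⁺ (startsWith i (suc i)) (suc n)
                     (IsPermutation-swap (IsPermutation-punchIn perm (s≤s z≤n) (s≤s i≤n)))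
                     π-noPattern
                     (subst (λ x → T (startsWith i (suc i) (x ∷ suc i ∷ τ))) (sym punchIn-i) (startsWith⁺ i (suc i) τ))
    where
    τ = map (punchIn (suc i)) ρ
    1+i∉ : suc i ∉ τ
    1+i∉ = All¬⇒¬Any (All.tabulate (λ v∈ → let (v , _ , v≡) = ∈-map⁻ (punchIn (suc i)) v∈ in
                                              λ 1+i≡ → punchIn≢ (suc i) v (trans 1+i≡ v≡)))
    π-noPattern : hasPattern (inflateHead i (i ∷ ρ)) ≡ false
    π-noPattern = begin
      hasPattern (punchIn (suc i) i ∷ suc i ∷ τ)  ≡⟨ cong (λ x → hasPattern (x ∷ suc i ∷ τ)) punchIn-i ⟩
      hasPattern (i ∷ suc i ∷ τ)                  ≡⟨ hasPattern-suc-second i τ 1+i∉ ⟩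
      hasPattern (i ∷ τ)                          ≡⟨ cong (λ x → hasPattern (x ∷ τ)) (sym punchIn-i) ⟩
      hasPattern (map (punchIn (suc i)) (i ∷ ρ))  ≡⟨ hasPattern-map (punchIn (suc i)) (punchIn-<ᵇ (suc i)) (i ∷ ρ) ⟩
      hasPattern (i ∷ ρ)                          ≡⟨ noPattern ⟩
      false                                       ∎
      where open ≡-Reasoning

  inflateHead-injective : ∀ {σ σ′} → inflateHead i σ ≡ inflateHead i σ′ → σ ≡ σ′
  inflateHead-injective = map-injective (punchIn-injective (suc i)) ∘ insertSecond-injective (suc i)

  lhs↭rhs : lhs ↭ rhs
  lhs↭rhs = unique-⊆-⊇⇒↭ (avoidersWith-unique _ (suc n))
              (Unique.map⁺ inflateHead-injective (avoidersWith-unique (headIs i) n)) fromLhs fromRhs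

  desc-inflateHead : ∀ {σ} → σ ∈ avoidersWith (headIs i) n → desc (inflateHead i σ) ≡ desc σ
  desc-inflateHead {σ} σ∈ with ∈-avoidersWith⁻ (headIs i) n σ∈
  ... | (_ , _ , uσ) , _ , hd with headIs⁻ i σ hd
  ... | [] , refl rewrite punchIn-i | ≥⇒<ᵇ≡false {suc i} {i} (n≤1+n i) = refl
  ... | r ∷ ρ , refl rewrite punchIn-i | ≥⇒<ᵇ≡false {suc i} {i} (n≤1+n i) =
    cong₂ Nat._+_ (cong (if_then 1 else 0) (second<ᵇ r (All.head (AllPairs.head uσ))))
                  (desc-map (punchIn (suc i)) (punchIn-<ᵇ (suc i)) (r ∷ ρ))
    where
    second<ᵇ : ∀ r → i ≢ r → (punchIn (suc i) r <ᵇ suc i) ≡ (r <ᵇ i)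
    second<ᵇ r i≢r with <ᵇ-cases r (suc i)
    ... | inj₁ (r<1+i , eq) rewrite punchIn-< r<1+i =
      trans eq (sym (<⇒<ᵇ≡true (≤∧≢⇒< (≤-pred r<1+i) (≢-sym i≢r))))
    ... | inj₂ (1+i≤r , _) rewrite punchIn-≥ 1+i≤r = refl

module MaxFirst (k : ℕ) (0<k : 0 < k) where

  lhs rhs : List (List ℕ)
  lhs = avoidersWith (headIs (suc k)) (suc k)
  rhs = map (suc k ∷_) (avoidersWith (headLe k) k)

  fromLhs : ∀ {π} → π ∈ lhs → π ∈ rhs
  fromLhs {π} π∈ with ∈-avoidersWith⁻ (headIs (suc k)) (suc k) π∈
  ... | perm , noPattern , hd with headIs⁻ (suc k) π hd
  ... | σ , refl = ∈-map⁺ (suc k ∷_) (∈-avoidersWith⁺ (headLe k) k (IsPermutation-drop-max perm)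
                     (trans (sym (hasPattern-max-head (suc k) σ (IsPermutation-max perm))) noPattern)
                     (head≤k σ (IsPermutation-drop-max perm) (IsPermutation-max perm)))
    where
    head≤k : ∀ σ → IsPermutation k σ → All (_< suc k) σ → T (headLe k σ)
    head≤k []      (len , _) _            = <-irrefl len 0<k
    head≤k (h ∷ _) _         (h<1+k ∷ _) = <⇒<ᵇ h<1+k

  fromRhs : ∀ {π} → π ∈ rhs → π ∈ lhs
  fromRhs {π} π∈ with ∈-map⁻ (suc k ∷_) π∈
  ... | σ , σ∈ , refl with ∈-avoidersWith⁻ (headLe k) k σ∈
  ... | perm , noPattern , _ =
    ∈-avoidersWith⁺ (headIs (suc k)) (suc k) (IsPermutation-add-max perm)
      (trans (hasPattern-max-head (suc k) σ (IsPermutation-max (IsPermutation-add-max perm))) noPattern)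
      (≡⇒≡ᵇ (suc k) (suc k) refl)

  lhs↭rhs : lhs ↭ rhs
  lhs↭rhs = unique-⊆-⊇⇒↭ (avoidersWith-unique _ (suc k))
              (Unique.map⁺ ∷-injectiveʳ (avoidersWith-unique (headLe k) k)) fromLhs fromRhs

  desc-∷ : ∀ {σ} → σ ∈ avoidersWith (headLe k) k → desc (suc k ∷ σ) ≡ suc (desc σ)
  desc-∷ {σ} σ∈ with ∈-avoidersWith⁻ (headLe k) k σ∈
  desc-∷ {[]}     σ∈ | _ , _ , ()
  desc-∷ {h ∷ σ′} σ∈ | _ , _ , h<1+k rewrite Equivalence.to T-≡ h<1+k = refl

startsWith-gap-empty : ∀ n i j → suc i < j → j < n → avoidersWith (startsWith i j) n ≡ []
startsWith-gap-empty n i j 1+i<j j<n with avoidersWith (startsWith i j) n in eq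
... | []    = refl
... | π ∷ _ = ⊥-elim (impossible (subst (π ∈_) (sym eq) (here refl)))
  where
  impossible : π ∉ avoidersWith (startsWith i j) n
  impossible π∈ with ∈-avoidersWith⁻ (startsWith i j) n π∈
  ... | perm , noPattern , st with startsWith⁻ i j π st
  ... | ρ , refl = subst T noPattern (hasPattern-forced ρ (n<1+n i) 1+i<j j<n 1+i∈ n∈)
    where
    1+i∈ = ∈-drop₂ (IsPermutation-∈ perm (s≤s z≤n) (<⇒≤ (<-trans 1+i<j j<n)))
             (λ eq → <-irrefl (sym eq) (n<1+n i)) (λ eq → <-irrefl eq 1+i<j)
    n∈   = ∈-drop₂ (IsPermutation-∈ perm (<-≤-trans (s≤s z≤n) j<n) ≤-refl)
             (λ eq → <-irrefl (sym eq) (<-trans (<-trans (n<1+n i) 1+i<j) j<n)) (λ eq → <-irrefl (sym eq) j<n)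

module WeightedSums {c ℓ : Level} (R : CommutativeSemiring c ℓ) (q : CommutativeSemiring.Carrier R) where
  open CommutativeSemiring R renaming (refl to ≈-refl; sym to ≈-sym; trans to ≈-trans) hiding (zero)
  open Gen R
  open import Relation.Binary.Reasoning.Setoid setoid
  open import Algebra.Properties.CommutativeSemigroup +-commutativeSemigroup using (interchange)
  import Data.List.Relation.Binary.Permutation.Setoid.Properties setoid as PermutationSetoid

  sumR-↭ : ∀ {xs ys} → xs ↭ ys → sumR xs ≈ sumR ys
  sumR-↭ p = PermutationSetoid.foldr-commMonoid +-isCommutativeMonoid (↭⇒↭ₛ′ isEquivalence p)

  sumR-++ : ∀ xs ys → sumR (xs ++ ys) ≈ sumR xs + sumR ys
  sumR-++ []       ys = ≈-sym (+-identityˡ _)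
  sumR-++ (x ∷ xs) ys = ≈-trans (+-congˡ (sumR-++ xs ys)) (≈-sym (+-assoc x _ _))

  sumR-cong : ∀ (f g : A → Carrier) xs → (∀ {x} → x ∈ xs → f x ≈ g x) → sumR (map f xs) ≈ sumR (map g xs)
  sumR-cong f g []       _   = ≈-refl
  sumR-cong f g (x ∷ xs) f≈g = +-cong (f≈g (here ≡.refl)) (sumR-cong f g xs (f≈g ∘ there))

  sumR-*ˡ : ∀ (f : A → Carrier) xs → sumR (map (λ x → q * f x) xs) ≈ q * sumR (map f xs)
  sumR-*ˡ f []       = ≈-sym (zeroʳ q)
  sumR-*ˡ f (x ∷ xs) = ≈-trans (+-congˡ (sumR-*ˡ f xs)) (≈-sym (distribˡ q (f x) _))

  sumR-zero : ∀ (xs : List A) → sumR (map (λ _ → 0#) xs) ≈ 0#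
  sumR-zero []       = ≈-refl
  sumR-zero (x ∷ xs) = ≈-trans (+-identityˡ _) (sumR-zero xs)

  sumR-+ : ∀ (f g : A → Carrier) xs → sumR (map (λ x → f x + g x) xs) ≈ sumR (map f xs) + sumR (map g xs)
  sumR-+ f g []       = ≈-sym (+-identityˡ 0#)
  sumR-+ f g (x ∷ xs) = ≈-trans (+-congˡ (sumR-+ f g xs)) (interchange (f x) (g x) _ _)

  sumR-comm : ∀ (f : A → B → Carrier) xs ys →
              sumR (map (λ x → sumR (map (f x) ys)) xs) ≈ sumR (map (λ y → sumR (map (λ x → f x y) xs)) ys)
  sumR-comm f []       ys = ≈-sym (sumR-zero ys)
  sumR-comm f (x ∷ xs) ys =
    ≈-trans (+-congˡ (sumR-comm f xs ys)) (≈-sym (sumR-+ (f x) (λ y → sumR (map (λ x → f x y) xs)) ys))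

  weight : List ℕ → Carrier
  weight π = pow q (desc π)

  total : List (List ℕ) → Carrier
  total πs = sumR (map weight πs)

  total-↭ : ∀ {πs σs} → πs ↭ σs → total πs ≈ total σs
  total-↭ p = sumR-↭ (Permutation.map⁺ weight p)

  total-++ : ∀ πs σs → total (πs ++ σs) ≈ total πs + total σs
  total-++ πs σs = ≈-trans (reflexive (cong sumR (map-++ weight πs σs))) (sumR-++ (map weight πs) (map weight σs))

  total-map-desc-suc : ∀ (φ : List ℕ → List ℕ) σs → (∀ {σ} → σ ∈ σs → desc (φ σ) ≡ suc (desc σ)) →
                       total (map φ σs) ≈ q * total σs
  total-map-desc-suc φ σs desc-suc = begin
    sumR (map weight (map φ σs))        ≡⟨ cong sumR (≡.sym (map-∘ σs)) ⟩
    sumR (map (weight ∘ φ) σs)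
      ≈⟨ sumR-cong (weight ∘ φ) (λ σ → q * weight σ) σs (reflexive ∘ cong (pow q) ∘ desc-suc) ⟩
    sumR (map (λ σ → q * weight σ) σs)  ≈⟨ sumR-*ˡ weight σs ⟩
    q * total σs                        ∎

  total-map-desc : ∀ (φ : List ℕ → List ℕ) σs → (∀ {σ} → σ ∈ σs → desc (φ σ) ≡ desc σ) →
                   total (map φ σs) ≈ total σs
  total-map-desc φ σs desc-eq = begin
    sumR (map weight (map φ σs))  ≡⟨ cong sumR (≡.sym (map-∘ σs)) ⟩
    sumR (map (weight ∘ φ) σs)    ≈⟨ sumR-cong (weight ∘ φ) weight σs (reflexive ∘ cong (pow q) ∘ desc-eq) ⟩
    total σs                      ∎

  select : Bool → Carrier → Carrier
  select b x = if b then x else 0#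

  total-filter : ∀ (p : List ℕ → Bool) πs →
                 total (filter (λ π → T? (p π)) πs) ≈ sumR (map (λ π → select (p π) (weight π)) πs)
  total-filter p []       = ≈-refl
  total-filter p (π ∷ πs) with p π
  ... | true  = +-congˡ (total-filter p πs)
  ... | false = ≈-trans (total-filter p πs) (≈-sym (+-identityˡ _))

  sumR-total-filter : ∀ (p : A → List ℕ → Bool) (P : List ℕ → Bool) js πs →
    (∀ {π} → π ∈ πs → sumR (map (λ j → select (p j π) (weight π)) js) ≈ select (P π) (weight π)) →
    sumR (map (λ j → total (filter (λ π → T? (p j π)) πs)) js) ≈ total (filter (λ π → T? (P π)) πs)
  sumR-total-filter p P js πs pointwise = begin
    sumR (map (λ j → total (filter (λ π → T? (p j π)) πs)) js)
      ≈⟨ sumR-cong _ _ js (λ {j} _ → total-filter (p j) πs) ⟩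
    sumR (map (λ j → sumR (map (λ π → select (p j π) (weight π)) πs)) js)
      ≈⟨ sumR-comm (λ j π → select (p j π) (weight π)) js πs ⟩
    sumR (map (λ π → sumR (map (λ j → select (p j π) (weight π)) js)) πs)
      ≈⟨ sumR-cong _ _ πs pointwise ⟩
    sumR (map (λ π → select (P π) (weight π)) πs)
      ≈⟨ total-filter P πs ⟨
    total (filter (λ π → T? (P π)) πs) ∎

  sumR-select-miss : ∀ y x ks → y ∉ ks → sumR (map (λ k → select (y ≡ᵇ k) x) ks) ≈ 0#
  sumR-select-miss y x []       _  = ≈-refl
  sumR-select-miss y x (k ∷ ks) y∉ with y ≡ᵇ k in eq
  ... | true  = ⊥-elim (y∉ (here (≡ᵇ⇒≡ y k (subst T (≡.sym eq) tt))))
  ... | false = ≈-trans (+-identityˡ _) (sumR-select-miss y x ks (y∉ ∘ there))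

  sumR-select-hit : ∀ y x ks → Unique ks → y ∈ ks → sumR (map (λ k → select (y ≡ᵇ k) x) ks) ≈ x
  sumR-select-hit y x (k ∷ ks) (k∉ ∷ _) (here refl) rewrite Equivalence.to T-≡ (≡⇒≡ᵇ y y refl) =
    ≈-trans (+-congˡ (sumR-select-miss y x ks (All¬⇒¬Any k∉))) (+-identityʳ x)
  sumR-select-hit y x (k ∷ ks) (k∉ ∷ uks) (there y∈) with y ≡ᵇ k in eq
  ... | true  = ⊥-elim (All.lookup k∉ y∈ (≡.sym (≡ᵇ⇒≡ y k (subst T (≡.sym eq) tt))))
  ... | false = ≈-trans (+-identityˡ _) (sumR-select-hit y x ks uks y∈)

  a1≈total : ∀ k j → 0 < k → a1 q k j ≈ total (avoidersWith (headIs j) k)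
  a1≈total 1 0                   _ = ≈-refl
  a1≈total 1 1                   _ = ≈-sym (+-identityʳ 1#)
  a1≈total 1 (suc (suc j))       _ = ≈-refl
  a1≈total K@(suc (suc _)) j     _ =
    sumR-total-filter (λ j′ → startsWith j j′) (headIs j) seconds (avoiders K) pointwise
    where
    seconds = filter (λ j′ → T? (not (j′ ≡ᵇ j))) (range K)
    pointwise : ∀ {π} → π ∈ avoiders K →
                sumR (map (λ j′ → select (startsWith j j′ π) (weight π)) seconds) ≈ select (headIs j π) (weight π)
    pointwise {π} π∈ with ∈-avoiders⁻ K π∈
    pointwise {[]}         _ | (() , _) , _
    pointwise {_ ∷ []}     _ | (() , _) , _
    pointwise {x ∷ y ∷ ρ} _ | (_ , inRange , (x∉ ∷ _)) , _ with x ≡ᵇ j in eq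
    ... | false = sumR-zero seconds
    ... | true  = sumR-select-hit y (weight (x ∷ y ∷ ρ)) seconds
                    (Unique.filter⁺ (λ j′ → T? (not (j′ ≡ᵇ j))) (range-unique K))
                    (∈-filter⁺ (λ j′ → T? (not (j′ ≡ᵇ j))) (uncurry ∈-range⁺ (inRange (there (here refl))))
                       (≢⇒T-not-≡ᵇ (λ y≡j → All.head x∉ (≡.trans (≡ᵇ⇒≡ x j (subst T (≡.sym eq) tt))
                                                                    (≡.sym y≡j)))))

  a1sum≈total : ∀ k b → 0 < k → a1sum q k b ≈ total (avoidersWith (headLe b) k)
  a1sum≈total k b 0<k = begin
    sumR (map (a1 q k) (range b))
      ≈⟨ sumR-cong _ _ (range b) (λ {j} _ → a1≈total k j 0<k) ⟩
    sumR (map (λ j → total (avoidersWith (headIs j) k)) (range b))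
      ≈⟨ sumR-total-filter headIs (headLe b) (range b) (avoiders k) pointwise ⟩
    total (avoidersWith (headLe b) k) ∎
    where
    pointwise : ∀ {π} → π ∈ avoiders k →
                sumR (map (λ j → select (headIs j π) (weight π)) (range b)) ≈ select (headLe b π) (weight π)
    pointwise {π} π∈ with ∈-avoiders⁻ k π∈
    pointwise {[]}    _ | (len , _) , _ = ⊥-elim (<-irrefl len 0<k)
    pointwise {x ∷ ρ} _ | (_ , inRange , _) , _ with <ᵇ-cases x (suc b)
    ... | inj₁ (x≤b , eq) rewrite eq =
      sumR-select-hit x (weight (x ∷ ρ)) (range b) (range-unique b)
                      (∈-range⁺ (proj₁ (inRange (here refl))) (≤-pred x≤b))
    ... | inj₂ (b<x , eq) rewrite eq =
      sumR-select-miss x (weight (x ∷ ρ)) (range b)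
                       (λ x∈ → <-irrefl refl (≤-trans (s≤s (proj₂ (∈-range⁻ x∈))) b<x))

  a2-maxSecond : ∀ m i → 0 < i → i ≤ suc m →
    a2 q (3 Nat.+ m) i (3 Nat.+ m) ≈ q * a2 q (2 Nat.+ m) i (2 Nat.+ m) + q * a1sum q (suc m) (i ⊓ m)
  a2-maxSecond m i 0<i i≤1+m = begin
    total lhs
      ≈⟨ total-↭ lhs↭rhs ⟩
    total rhs
      ≈⟨ total-++ (map (insertSecond N) maxThird) (map (prependWithMax i N) lowHead) ⟩
    total (map (insertSecond N) maxThird) + total (map (prependWithMax i N) lowHead)
      ≈⟨ +-cong (total-map-desc-suc _ maxThird desc-insertSecond) (total-map-desc-suc _ lowHead desc-prependWithMax) ⟩
    q * total maxThird + q * total lowHead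
      ≈⟨ +-congˡ (*-congˡ (a1sum≈total (suc m) (i ⊓ m) (s≤s z≤n))) ⟨
    q * total maxThird + q * a1sum q (suc m) (i ⊓ m) ∎
    where open MaxSecond m i 0<i i≤1+m

  a2-consecutive : ∀ n i → 0 < i → i ≤ n → a2 q (suc n) i (suc i) ≈ a1 q n i
  a2-consecutive n i 0<i i≤n = begin
    total lhs                               ≈⟨ total-↭ lhs↭rhs ⟩
    total rhs                               ≈⟨ total-map-desc (inflateHead i) _ desc-inflateHead ⟩
    total (avoidersWith (headIs i) n)       ≈⟨ a1≈total n i (≤-trans 0<i i≤n) ⟨
    a1 q n i                                ∎
    where open ConsecutiveStart n i 0<i i≤n

  total-maxFirst : ∀ k → 0 < k → total (avoidersWith (headIs (suc k)) (suc k)) ≈ q * a0 q k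
  total-maxFirst k 0<k = begin
    total lhs                                  ≈⟨ total-↭ lhs↭rhs ⟩
    total rhs                                  ≈⟨ total-map-desc-suc (suc k ∷_) _ desc-∷ ⟩
    q * total (avoidersWith (headLe k) k)      ≈⟨ *-congˡ (a1sum≈total k k 0<k) ⟨
    q * a0 q k                                 ∎
    where open MaxFirst k 0<k

  a2-gap : ∀ n i j → suc i < j → j < n → a2 q n i j ≈ 0#
  a2-gap n i j 1+i<j j<n rewrite startsWith-gap-empty n i j 1+i<j j<n = ≈-refl

lemma9 : {c ℓ : Level} (R : CommutativeSemiring c ℓ) (q : CommutativeSemiring.Carrier R) →
  let open CommutativeSemiring R
      open Gen R
  in ((n i : ℕ) → 1 ≤ i → i ≤ n ∸ 3 →
        a2 q n i n ≈ q * a2 q (n ∸ 1) i (n ∸ 1) + q * a1sum q (n ∸ 2) i)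
   × ((n : ℕ) → 4 ≤ n →
        a2 q n (n ∸ 2) n ≈ q * q * a0 q (n ∸ 3) + q * a1sum q (n ∸ 2) (n ∸ 3))
   × ((n i : ℕ) → 1 ≤ i → i ≤ n ∸ 1 →
        a2 q n i (suc i) ≈ a1 q (n ∸ 1) i)
   × ((n i j : ℕ) → 2 ≤ suc i → suc i < j → j < n →
        a2 q n i j ≈ 0#)
lemma9 R q = a2-i-n , a2-n∸2-n , a2-i-suc-i , λ n i j _ → a2-gap n i j
  where
  open CommutativeSemiring R renaming (refl to ≈-refl; sym to ≈-sym; trans to ≈-trans) hiding (zero)
  open Gen R
  open WeightedSums R q
  open import Relation.Binary.Reasoning.Setoid setoid

  a2-i-n : (n i : ℕ) → 1 ≤ i → i ≤ n ∸ 3 → a2 q n i n ≈ q * a2 q (n ∸ 1) i (n ∸ 1) + q * a1sum q (n ∸ 2) i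
  a2-i-n (suc (suc (suc m))) i 1≤i i≤m =
    ≈-trans (a2-maxSecond m i 1≤i (m≤n⇒m≤1+n i≤m))
            (+-congˡ (*-congˡ (reflexive (cong (a1sum q (suc m)) (m≤n⇒m⊓n≡m i≤m)))))
  a2-i-n 0 _ (s≤s _) ()
  a2-i-n 1 _ (s≤s _) ()
  a2-i-n 2 _ (s≤s _) ()

  a2-n∸2-n : (n : ℕ) → 4 ≤ n → a2 q n (n ∸ 2) n ≈ q * q * a0 q (n ∸ 3) + q * a1sum q (n ∸ 2) (n ∸ 3)
  a2-n∸2-n (suc (suc (suc (suc m)))) _ = begin
    a2 q (2 Nat.+ k) k (2 Nat.+ k)
      ≈⟨ a2-maxSecond (suc m) k (s≤s z≤n) ≤-refl ⟩
    q * a2 q (suc k) k (suc k) + q * a1sum q k (k ⊓ suc m)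
      ≈⟨ +-congˡ (*-congˡ (reflexive (cong (a1sum q k) (m≥n⇒m⊓n≡n (n≤1+n (suc m)))))) ⟩
    q * a2 q (suc k) k (suc k) + q * a1sum q k (suc m)
      ≈⟨ +-congʳ (*-congˡ (≈-trans (a2-consecutive k k (s≤s z≤n) ≤-refl) (a1≈total k k (s≤s z≤n)))) ⟩
    q * total (avoidersWith (headIs k) k) + q * a1sum q k (suc m)
      ≈⟨ +-congʳ (*-congˡ (total-maxFirst (suc m) (s≤s z≤n))) ⟩
    q * (q * a0 q (suc m)) + q * a1sum q k (suc m)
      ≈⟨ +-congʳ (*-assoc q q _) ⟨
    q * q * a0 q (suc m) + q * a1sum q k (suc m) ∎
    where k = suc (suc m)
  a2-n∸2-n 0 ()
  a2-n∸2-n 1 (s≤s ())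
  a2-n∸2-n 2 (s≤s (s≤s ()))
  a2-n∸2-n 3 (s≤s (s≤s (s≤s ())))

  a2-i-suc-i : (n i : ℕ) → 1 ≤ i → i ≤ n ∸ 1 → a2 q n i (suc i) ≈ a1 q (n ∸ 1) i
  a2-i-suc-i (suc n) i 1≤i i≤n = a2-consecutive n i 1≤i i≤n
  a2-i-suc-i 0 _ (s≤s _) ()
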